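{- The rewriting system $\lambda\upsilon'$ is confluent on the set of well-formed terms: if $a$ is well-formed and $a\twoheadrightarrow b$, $a\twoheadrightarrow c$ in $\lambda\upsilon'$, then there is $d$ with $b\twoheadrightarrow d$ and $c\twoheadrightarrow d$ in $\lambda\upsilon'$.
   Context: Named variables $x,y,z,\ldots$ ($\mathsf{x}$ ranges over them). Terms and substitutions: $a,b::=\mathsf{x}\mid\underline{1}\mid ab\mid\lambda a\mid a[s]$, $s::=b/\mid\,\uparrow\,\mid id\mid\,\Uparrow\! s$; $a[s][t]$ means $(a[s])[t]$. The system $\lambda\upsilon'$ consists of the following rules applicable to any subterm (including inside $b/$ and $\Uparrow\! s$): (Beta) $(\lambda a)b\to a[b/]$; (App) $(ab)[s]\to(a[s])(b[s])$; (Lambda) $(\lambda a)[s]\to\lambda(a[\Uparrow\! s])$; (Var) $\underline{1}[b/]\to b$; (Shift) $a[\uparrow][b/]\to a$; (VarId) $\underline{1}[id]\to\underline{1}$; (ShiftId) $a[\uparrow][id]\to a[\uparrow]$; (VarLift) $\underline{1}[\Uparrow\! s]\to\underline{1}$; (ShiftLift) $a[\uparrow][\Uparrow\! s]\to a[s][\uparrow]$. $\twoheadrightarrow$ is the reflexive-transitive closure. Judgements $n\vdash a$ and $n\vdash s\triangleright m$ ($n,m\in\mathbb{N}$) are derived by: $0\vdash\mathsf{x}$; $n+1\vdash\underline{1}$; from $n\vdash a$, $n\vdash b$ infer $n\vdash ab$; from $n+1\vdash a$ infer $n\vdash\lambda a$; from $n\vdash s\triangleright m$, $m\vdash a$ infer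 $n\vdash a[s]$; from $n\vdash b$ infer $n\vdash b/\triangleright n+1$; $n+1\vdash\,\uparrow\triangleright n$; $n+1\vdash id\triangleright n+1$; from $n\vdash s\triangleright m$ infer $n+1\vdash\,\Uparrow\! s\triangleright m+1$. A term $a$ is well-formed iff $n\vdash a$ is derivable for some $n$. -}

module Defs where

open import Data.Nat using (ℕ; zero; suc)
open import Data.Product using (Σ; _×_; _,_)

-- Named variables are represented by natural numbers (an infinite set of names).
Name : Set
Name = ℕ

mutual
  data Term : Set where
    var  : Name → Term
    one  : Term                 -- de Bruijn index 1
    app  : Term → Term → Term
    lam  : Term → Term
    clos : Term → Subst → Term

  data Subst : Set where
    slash : Term → Subst
    shift : Subst
    ids   : Subst
    lift  : Subst → Subst

mutual
  data _⟶_ : Term → Term → Set where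
    Beta      : ∀ a b → app (lam a) b ⟶ clos a (slash b)
    App       : ∀ a b s → clos (app a b) s ⟶ app (clos a s) (clos b s)
    Lambda    : ∀ a s → clos (lam a) s ⟶ lam (clos a (lift s))
    Var       : ∀ b → clos one (slash b) ⟶ b
    Shift     : ∀ a b → clos (clos a shift) (slash b) ⟶ a
    VarId     : clos one ids ⟶ one
    ShiftId   : ∀ a → clos (clos a shift) ids ⟶ clos a shift
    VarLift   : ∀ s → clos one (lift s) ⟶ one
    ShiftLift : ∀ a s → clos (clos a shift) (lift s) ⟶ clos (clos a s) shift
    appL  : ∀ {a a'} b → a ⟶ a' → app a b ⟶ app a' b
    appR  : ∀ a {b b'} → b ⟶ b' → app a b ⟶ app a b'
    lamC  : ∀ {a a'} → a ⟶ a' → lam a ⟶ lam a'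
    closL : ∀ {a a'} s → a ⟶ a' → clos a s ⟶ clos a' s
    closR : ∀ a {s s'} → s ⟶ₛ s' → clos a s ⟶ clos a s'

  data _⟶ₛ_ : Subst → Subst → Set where
    slashC : ∀ {b b'} → b ⟶ b' → slash b ⟶ₛ slash b'
    liftC  : ∀ {s s'} → s ⟶ₛ s' → lift s ⟶ₛ lift s'

data _↠_ : Term → Term → Set where
  refl↠ : ∀ {a} → a ↠ a
  step↠ : ∀ {a b c} → a ⟶ b → b ↠ c → a ↠ c

mutual
  data _⊢_ : ℕ → Term → Set where
    wf-var  : ∀ x → 0 ⊢ var x
    wf-one  : ∀ n → suc n ⊢ one
    wf-app  : ∀ {n a b} → n ⊢ a → n ⊢ b → n ⊢ app a b
    wf-lam  : ∀ {n a} → suc n ⊢ a → n ⊢ lam a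
    wf-clos : ∀ {n m a s} → n ⊢ s ▷ m → m ⊢ a → n ⊢ clos a s

  data _⊢_▷_ : ℕ → Subst → ℕ → Set where
    wf-slash : ∀ {n b} → n ⊢ b → n ⊢ slash b ▷ suc n
    wf-shift : ∀ n → suc n ⊢ shift ▷ n
    wf-id    : ∀ n → suc n ⊢ ids ▷ suc n
    wf-lift  : ∀ {n m s} → n ⊢ s ▷ m → suc n ⊢ lift s ▷ suc m

WellFormed : Term → Set
WellFormed a = Σ ℕ (λ n → n ⊢ a)

module Submission where

-- Every λυ'-term a denotes a pure λ-term ⟦ a ⟧ (de Bruijn indices plus
-- named constants) obtained by carrying out all explicit substitutions.
--  (1) Pure λ-terms: renaming and substitution and their fusion laws.
--  (2) Parallel β-reduction ⇛ has the triangle property with respect to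
--      complete development, hence ⇛* is confluent (a general fact about
--      any relation with a triangle function).
--  (3) Simulation: one λυ'-step a ⟶ b gives ⟦ a ⟧ ⇛ ⟦ b ⟧.
--  (4) Subject reduction: λυ' preserves the judgement n ⊢ a.
--  (5) Readback: a λ-term t is read back at level n as a substitution-free
--      λυ'-term readback n t.  A well-formed term reduces to the readback of
--      its interpretation, and ⇛-steps lift to λυ'-reductions of readbacks.
-- The theorem follows: given a ↠ b and a ↠ c, join ⟦ b ⟧ and ⟦ c ⟧ in ⇛*
-- at some t, and read back t at the level at which a is well-formed.

open import Defs
open import Data.Nat using (ℕ; zero; suc)
open import Data.Product using (Σ; ∃; _×_; _,_)
open import Function using (_∘_)
open import Level using (0ℓ)
open import Relation.Binary.Core using (Rel)
open import Relation.Binary.Construct.Closure.ReflexiveTransitive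
  using (Star; ε; _◅_; _◅◅_; gmap)
open import Relation.Binary.Rewriting using (Confluent)
open import Relation.Binary.PropositionalEquality
  using (_≡_; _≗_; refl; sym; trans; cong; cong₂; subst)

-- (1) Pure λ-terms with constants

infixl 7 _·_

data Λ : Set where
  con : Name → Λ
  ix  : ℕ → Λ          -- de Bruijn index, counting from 0
  _·_ : Λ → Λ → Λ
  ƛ   : Λ → Λ

Ren : Set
Ren = ℕ → ℕ

Sub : Set
Sub = ℕ → Λ

ext : Ren → Ren
ext ρ zero    = zero
ext ρ (suc k) = suc (ρ k)

ren : Ren → Λ → Λ
ren ρ (con x) = con x
ren ρ (ix i)  = ix (ρ i)
ren ρ (t · u) = ren ρ t · ren ρ u
ren ρ (ƛ t)   = ƛ (ren (ext ρ) t)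

exts : Sub → Sub
exts σ zero    = ix zero
exts σ (suc k) = ren suc (σ k)

sub : Sub → Λ → Λ
sub σ (con x) = con x
sub σ (ix i)  = σ i
sub σ (t · u) = sub σ t · sub σ u
sub σ (ƛ t)   = ƛ (sub (exts σ) t)

infixr 5 _•_

_•_ : Λ → Sub → Sub
(u • σ) zero    = u
(u • σ) (suc k) = σ k

ext-cong : ∀ {ρ ρ'} → ρ ≗ ρ' → ext ρ ≗ ext ρ'
ext-cong e zero    = refl
ext-cong e (suc k) = cong suc (e k)

ren-cong : ∀ {ρ ρ'} → ρ ≗ ρ' → ren ρ ≗ ren ρ'
ren-cong e (con x) = refl
ren-cong e (ix i)  = cong ix (e i)
ren-cong e (t · u) = cong₂ _·_ (ren-cong e t) (ren-cong e u)
ren-cong e (ƛ t)   = cong ƛ (ren-cong (ext-cong e) t)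

exts-cong : ∀ {σ τ} → σ ≗ τ → exts σ ≗ exts τ
exts-cong e zero    = refl
exts-cong e (suc k) = cong (ren suc) (e k)

sub-cong : ∀ {σ τ} → σ ≗ τ → sub σ ≗ sub τ
sub-cong e (con x) = refl
sub-cong e (ix i)  = e i
sub-cong e (t · u) = cong₂ _·_ (sub-cong e t) (sub-cong e u)
sub-cong e (ƛ t)   = cong ƛ (sub-cong (exts-cong e) t)

ren-ren : ∀ ρ ρ' t → ren ρ (ren ρ' t) ≡ ren (ρ ∘ ρ') t
ren-ren ρ ρ' (con x) = refl
ren-ren ρ ρ' (ix i)  = refl
ren-ren ρ ρ' (t · u) = cong₂ _·_ (ren-ren ρ ρ' t) (ren-ren ρ ρ' u)
ren-ren ρ ρ' (ƛ t)   =
  cong ƛ (trans (ren-ren (ext ρ) (ext ρ') t) (ren-cong ext-comp t))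
  where
  ext-comp : ext ρ ∘ ext ρ' ≗ ext (ρ ∘ ρ')
  ext-comp zero    = refl
  ext-comp (suc k) = refl

ren-sub : ∀ ρ σ t → ren ρ (sub σ t) ≡ sub (ren ρ ∘ σ) t
ren-sub ρ σ (con x) = refl
ren-sub ρ σ (ix i)  = refl
ren-sub ρ σ (t · u) = cong₂ _·_ (ren-sub ρ σ t) (ren-sub ρ σ u)
ren-sub ρ σ (ƛ t)   =
  cong ƛ (trans (ren-sub (ext ρ) (exts σ) t) (sub-cong ext-exts t))
  where
  ext-exts : ren (ext ρ) ∘ exts σ ≗ exts (ren ρ ∘ σ)
  ext-exts zero    = refl
  ext-exts (suc k) = trans (ren-ren (ext ρ) suc (σ k)) (sym (ren-ren suc ρ (σ k)))

sub-ren : ∀ σ ρ t → sub σ (ren ρ t) ≡ sub (σ ∘ ρ) t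
sub-ren σ ρ (con x) = refl
sub-ren σ ρ (ix i)  = refl
sub-ren σ ρ (t · u) = cong₂ _·_ (sub-ren σ ρ t) (sub-ren σ ρ u)
sub-ren σ ρ (ƛ t)   =
  cong ƛ (trans (sub-ren (exts σ) (ext ρ) t) (sub-cong exts-ext t))
  where
  exts-ext : exts σ ∘ ext ρ ≗ exts (σ ∘ ρ)
  exts-ext zero    = refl
  exts-ext (suc k) = refl

sub-sub : ∀ σ τ t → sub σ (sub τ t) ≡ sub (sub σ ∘ τ) t
sub-sub σ τ (con x) = refl
sub-sub σ τ (ix i)  = refl
sub-sub σ τ (t · u) = cong₂ _·_ (sub-sub σ τ t) (sub-sub σ τ u)
sub-sub σ τ (ƛ t)   =
  cong ƛ (trans (sub-sub (exts σ) (exts τ) t) (sub-cong exts-exts t))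
  where
  exts-exts : sub (exts σ) ∘ exts τ ≗ exts (sub σ ∘ τ)
  exts-exts zero    = refl
  exts-exts (suc k) = trans (sub-ren (exts σ) suc (τ k)) (sym (ren-sub suc σ (τ k)))

sub-id : ∀ t → sub ix t ≡ t
sub-id (con x) = refl
sub-id (ix i)  = refl
sub-id (t · u) = cong₂ _·_ (sub-id t) (sub-id u)
sub-id (ƛ t)   = cong ƛ (trans (sub-cong exts-ix t) (sub-id t))
  where
  exts-ix : exts ix ≗ ix
  exts-ix zero    = refl
  exts-ix (suc k) = refl

ren-as-sub : ∀ ρ t → ren ρ t ≡ sub (ix ∘ ρ) t
ren-as-sub ρ (con x) = refl
ren-as-sub ρ (ix i)  = refl
ren-as-sub ρ (t · u) = cong₂ _·_ (ren-as-sub ρ t) (ren-as-sub ρ u)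
ren-as-sub ρ (ƛ t)   = cong ƛ (trans (ren-as-sub (ext ρ) t) (sub-cong ix-ext t))
  where
  ix-ext : ix ∘ ext ρ ≗ exts (ix ∘ ρ)
  ix-ext zero    = refl
  ix-ext (suc k) = refl

-- Renamings and substitutions commute with β-substitution; these are what
-- make parallel reduction stable under renaming and substitution.
ren-beta : ∀ ρ u t → ren ρ (sub (u • ix) t) ≡ sub (ren ρ u • ix) (ren (ext ρ) t)
ren-beta ρ u t =
  trans (ren-sub ρ (u • ix) t)
        (trans (sub-cong pointwise t) (sym (sub-ren (ren ρ u • ix) (ext ρ) t)))
  where
  pointwise : ren ρ ∘ (u • ix) ≗ (ren ρ u • ix) ∘ ext ρ
  pointwise zero    = refl
  pointwise (suc k) = refl

sub-beta : ∀ σ u t → sub σ (sub (u • ix) t) ≡ sub (sub σ u • ix) (sub (exts σ) t)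
sub-beta σ u t =
  trans (sub-sub σ (u • ix) t)
        (trans (sub-cong pointwise t) (sym (sub-sub (sub σ u • ix) (exts σ) t)))
  where
  pointwise : sub σ ∘ (u • ix) ≗ sub (sub σ u • ix) ∘ exts σ
  pointwise zero    = refl
  pointwise (suc k) = sym (trans (sub-ren (sub σ u • ix) suc (σ k)) (sub-id (σ k)))

-- (2) Parallel reduction and its confluence

-- A relation with a triangle function is confluent: every one-step
-- reduct of t reduces in one step to dev t (Takahashi's argument).
module _ {A : Set} {_▷_ : Rel A 0ℓ} (dev : A → A)
         (triangle : ∀ {t u} → t ▷ u → u ▷ dev t) where

  strip : ∀ {t u w} → t ▷ u → Star _▷_ t w → ∃ λ z → Star _▷_ u z × (w ▷ z)
  strip {u = u} t▷u ε  = u , ε , t▷u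
  strip t▷u (t▷v ◅ v▷*w) with strip (triangle t▷v) v▷*w
  ... | z , dev▷*z , w▷z = z , triangle t▷u ◅ dev▷*z , w▷z

  triangle⇒confluent : Confluent _▷_
  triangle⇒confluent {C = w} ε t▷*w = w , t▷*w , ε
  triangle⇒confluent (t▷u ◅ u▷*v) t▷*w with strip t▷u t▷*w
  ... | z , u▷*z , w▷z with triangle⇒confluent u▷*v u▷*z
  ... | y , v▷*y , z▷*y = y , v▷*y , w▷z ◅ z▷*y

infix 4 _⇛_

data _⇛_ : Λ → Λ → Set where
  ⇛con : ∀ x → con x ⇛ con x
  ⇛ix  : ∀ i → ix i ⇛ ix i
  ⇛app : ∀ {t t' u u'} → t ⇛ t' → u ⇛ u' → t · u ⇛ t' · u'
  ⇛lam : ∀ {t t'} → t ⇛ t' → ƛ t ⇛ ƛ t'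
  ⇛β   : ∀ {t t' u u'} → t ⇛ t' → u ⇛ u' → ƛ t · u ⇛ sub (u' • ix) t'

⇛-refl : ∀ t → t ⇛ t
⇛-refl (con x) = ⇛con x
⇛-refl (ix i)  = ⇛ix i
⇛-refl (t · u) = ⇛app (⇛-refl t) (⇛-refl u)
⇛-refl (ƛ t)   = ⇛lam (⇛-refl t)

≡⇒⇛ : ∀ {t u} → t ≡ u → t ⇛ u
≡⇒⇛ {t} refl = ⇛-refl t

ren-⇛ : ∀ ρ {t t'} → t ⇛ t' → ren ρ t ⇛ ren ρ t'
ren-⇛ ρ (⇛con x)   = ⇛con x
ren-⇛ ρ (⇛ix i)    = ⇛ix (ρ i)
ren-⇛ ρ (⇛app p q) = ⇛app (ren-⇛ ρ p) (ren-⇛ ρ q)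
ren-⇛ ρ (⇛lam p)   = ⇛lam (ren-⇛ (ext ρ) p)
ren-⇛ ρ (⇛β {t} {t'} {u} {u'} p q) =
  subst (ren ρ (ƛ t · u) ⇛_) (sym (ren-beta ρ u' t'))
        (⇛β (ren-⇛ (ext ρ) p) (ren-⇛ ρ q))

_⇛ₛ_ : Sub → Sub → Set
σ ⇛ₛ τ = ∀ k → σ k ⇛ τ k

exts-⇛ : ∀ {σ τ} → σ ⇛ₛ τ → exts σ ⇛ₛ exts τ
exts-⇛ σ⇛τ zero    = ⇛ix zero
exts-⇛ σ⇛τ (suc k) = ren-⇛ suc (σ⇛τ k)

cons-⇛ : ∀ {u u'} → u ⇛ u' → (u • ix) ⇛ₛ (u' • ix)
cons-⇛ u⇛u' zero    = u⇛u'
cons-⇛ u⇛u' (suc k) = ⇛ix k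

sub-⇛ : ∀ {σ τ} → σ ⇛ₛ τ → ∀ {t t'} → t ⇛ t' → sub σ t ⇛ sub τ t'
sub-⇛ σ⇛τ (⇛con x)   = ⇛con x
sub-⇛ σ⇛τ (⇛ix i)    = σ⇛τ i
sub-⇛ σ⇛τ (⇛app p q) = ⇛app (sub-⇛ σ⇛τ p) (sub-⇛ σ⇛τ q)
sub-⇛ σ⇛τ (⇛lam p)   = ⇛lam (sub-⇛ (exts-⇛ σ⇛τ) p)
sub-⇛ {σ} {τ} σ⇛τ (⇛β {t} {t'} {u} {u'} p q) =
  subst (sub σ (ƛ t · u) ⇛_) (sym (sub-beta τ u' t'))
        (⇛β (sub-⇛ (exts-⇛ σ⇛τ) p) (sub-⇛ σ⇛τ q))

-- In the
-- triangle lemma the application case is split on the head's derivation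
-- because develop treats an application with a λ-head specially.
develop : Λ → Λ
develop (con x)     = con x
develop (ix i)      = ix i
develop (ƛ t · u)   = sub (develop u • ix) (develop t)
develop (t · u)     = develop t · develop u
develop (ƛ t)       = ƛ (develop t)

⇛-triangle : ∀ {t u} → t ⇛ u → u ⇛ develop t
⇛-triangle (⇛con x)                = ⇛con x
⇛-triangle (⇛ix i)                 = ⇛ix i
⇛-triangle (⇛lam p)                = ⇛lam (⇛-triangle p)
⇛-triangle (⇛β p q)                = sub-⇛ (cons-⇛ (⇛-triangle q)) (⇛-triangle p)
⇛-triangle (⇛app (⇛lam p) q)       = ⇛β (⇛-triangle p) (⇛-triangle q)
⇛-triangle (⇛app p@(⇛con _) q)     = ⇛app (⇛-triangle p) (⇛-triangle q)
⇛-triangle (⇛app p@(⇛ix _) q)      = ⇛app (⇛-triangle p) (⇛-triangle q)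
⇛-triangle (⇛app p@(⇛app _ _) q)   = ⇛app (⇛-triangle p) (⇛-triangle q)
⇛-triangle (⇛app p@(⇛β _ _) q)     = ⇛app (⇛-triangle p) (⇛-triangle q)

⇛-confluent : Confluent _⇛_
⇛-confluent = triangle⇒confluent develop ⇛-triangle

-- (3) Interpretation of λυ'-terms and simulation of λυ'-steps

infix 4 _⟶*_ _⟶ₛ*_

_⟶*_ : Term → Term → Set
_⟶*_ = Star _⟶_

_⟶ₛ*_ : Subst → Subst → Set
_⟶ₛ*_ = Star _⟶ₛ_

mutual
  ⟦_⟧ : Term → Λ
  ⟦ var x ⟧    = con x
  ⟦ one ⟧      = ix zero
  ⟦ app a b ⟧  = ⟦ a ⟧ · ⟦ b ⟧
  ⟦ lam a ⟧    = ƛ ⟦ a ⟧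
  ⟦ clos a s ⟧ = sub ⟦ s ⟧ₛ ⟦ a ⟧

  ⟦_⟧ₛ : Subst → Sub
  ⟦ slash b ⟧ₛ = ⟦ b ⟧ • ix
  ⟦ shift ⟧ₛ   = ix ∘ suc
  ⟦ ids ⟧ₛ     = ix
  ⟦ lift s ⟧ₛ  = exts ⟦ s ⟧ₛ

shift-slash : ∀ u t → sub (u • ix) (sub (ix ∘ suc) t) ≡ t
shift-slash u t = trans (sub-sub (u • ix) (ix ∘ suc) t) (sub-id t)

shift-lift : ∀ σ t → sub (exts σ) (sub (ix ∘ suc) t) ≡ sub (ix ∘ suc) (sub σ t)
shift-lift σ t =
  trans (sub-sub (exts σ) (ix ∘ suc) t)
        (trans (sub-cong (ren-as-sub suc ∘ σ) t) (sym (sub-sub (ix ∘ suc) σ t)))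

mutual
  simulate : ∀ {a b} → a ⟶ b → ⟦ a ⟧ ⇛ ⟦ b ⟧
  simulate (Beta a b)      = ⇛β (⇛-refl ⟦ a ⟧) (⇛-refl ⟦ b ⟧)
  simulate (App a b s)     = ⇛-refl _
  simulate (Lambda a s)    = ⇛-refl _
  simulate (Var b)         = ⇛-refl _
  simulate (Shift a b)     = ≡⇒⇛ (shift-slash ⟦ b ⟧ ⟦ a ⟧)
  simulate VarId           = ⇛-refl _
  simulate (ShiftId a)     = ≡⇒⇛ (sub-id _)
  simulate (VarLift s)     = ⇛-refl _
  simulate (ShiftLift a s) = ≡⇒⇛ (shift-lift ⟦ s ⟧ₛ ⟦ a ⟧)
  simulate (appL b p)      = ⇛app (simulate p) (⇛-refl _)
  simulate (appR a p)      = ⇛app (⇛-refl _) (simulate p)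
  simulate (lamC p)        = ⇛lam (simulate p)
  simulate (closL s p)     = sub-⇛ (⇛-refl ∘ ⟦ s ⟧ₛ) (simulate p)
  simulate (closR a p)     = sub-⇛ (simulateₛ p) (⇛-refl ⟦ a ⟧)

  simulateₛ : ∀ {s s'} → s ⟶ₛ s' → ⟦ s ⟧ₛ ⇛ₛ ⟦ s' ⟧ₛ
  simulateₛ (slashC p) = cons-⇛ (simulate p)
  simulateₛ (liftC p)  = exts-⇛ (simulateₛ p)

simulate* : ∀ {a b} → a ⟶* b → Star _⇛_ ⟦ a ⟧ ⟦ b ⟧
simulate* = gmap ⟦_⟧ simulate

-- (4) Subject reduction

mutual
  subject-reduction : ∀ {n a b} → n ⊢ a → a ⟶ b → n ⊢ b
  subject-reduction (wf-app (wf-lam A) B) (Beta a b) = wf-clos (wf-slash B) A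
  subject-reduction (wf-clos S (wf-app A B)) (App a b s) =
    wf-app (wf-clos S A) (wf-clos S B)
  subject-reduction (wf-clos S (wf-lam A)) (Lambda a s) = wf-lam (wf-clos (wf-lift S) A)
  subject-reduction (wf-clos (wf-slash B) (wf-one _)) (Var b) = B
  subject-reduction (wf-clos (wf-slash B) (wf-clos (wf-shift _) A)) (Shift a b) = A
  subject-reduction (wf-clos (wf-id _) (wf-one _)) VarId = wf-one _
  subject-reduction (wf-clos (wf-id _) A) (ShiftId a) = A
  subject-reduction (wf-clos (wf-lift S) (wf-one _)) (VarLift s) = wf-one _
  subject-reduction (wf-clos (wf-lift S) (wf-clos (wf-shift _) A)) (ShiftLift a s) =
    wf-clos (wf-shift _) (wf-clos S A)
  subject-reduction (wf-app A B) (appL b p) = wf-app (subject-reduction A p) B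
  subject-reduction (wf-app A B) (appR a p) = wf-app A (subject-reduction B p)
  subject-reduction (wf-lam A) (lamC p) = wf-lam (subject-reduction A p)
  subject-reduction (wf-clos S A) (closL s p) = wf-clos S (subject-reduction A p)
  subject-reduction (wf-clos S A) (closR a p) = wf-clos (subject-reductionₛ S p) A

  subject-reductionₛ : ∀ {n m s s'} → n ⊢ s ▷ m → s ⟶ₛ s' → n ⊢ s' ▷ m
  subject-reductionₛ (wf-slash B) (slashC p) = wf-slash (subject-reduction B p)
  subject-reductionₛ (wf-lift S) (liftC p)   = wf-lift (subject-reductionₛ S p)

subject-reduction* : ∀ {n a b} → n ⊢ a → a ⟶* b → n ⊢ b
subject-reduction* A ε          = A
subject-reduction* A (p ◅ a⟶*b) = subject-reduction* (subject-reduction A p) a⟶*b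

-- (5) Readback of λ-terms into λυ'

app* : ∀ {a a' b b'} → a ⟶* a' → b ⟶* b' → app a b ⟶* app a' b'
app* {a' = a'} {b = b} a⟶*a' b⟶*b' =
  gmap (λ z → app z b) (appL b) a⟶*a' ◅◅ gmap (app a') (appR a') b⟶*b'

lam* : ∀ {a a'} → a ⟶* a' → lam a ⟶* lam a'
lam* = gmap lam lamC

closL* : ∀ {a a'} s → a ⟶* a' → clos a s ⟶* clos a' s
closL* s = gmap (λ z → clos z s) (closL s)

closR* : ∀ a {s s'} → s ⟶ₛ* s' → clos a s ⟶* clos a s'
closR* a = gmap (clos a) (closR a)

shifts : ℕ → Term → Term
shifts zero    a = a
shifts (suc k) a = clos (shifts k a) shift

-- At level n, a constant is read back below n shifts (so that it is
-- well-formed there) and index i as 1[↑]^i.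
readback : ℕ → Λ → Term
readback n (con x) = shifts n (var x)
readback n (ix i)  = shifts i one
readback n (t · u) = app (readback n t) (readback n u)
readback n (ƛ t)   = lam (readback (suc n) t)

-- ShiftNf n s ρ m: s = ⇑…⇑↑ is a substitution from level m to level n
-- which denotes the renaming ρ.
data ShiftNf : ℕ → Subst → Ren → ℕ → Set where
  nf-shift : ∀ n → ShiftNf (suc n) shift suc n
  nf-lift  : ∀ {n s ρ m} → ShiftNf n s ρ m → ShiftNf (suc n) (lift s) (ext ρ) (suc m)

shiftNf-const : ∀ {n s ρ m} → ShiftNf n s ρ m → ∀ a → clos (shifts m a) s ⟶* shifts n a
shiftNf-const (nf-shift n)          a = ε
shiftNf-const (nf-lift {s = s} R)   a = ShiftLift _ s ◅ closL* shift (shiftNf-const R a)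

shiftNf-index : ∀ {n s ρ m} → ShiftNf n s ρ m → ∀ i → clos (shifts i one) s ⟶* shifts (ρ i) one
shiftNf-index (nf-shift n)        i       = ε
shiftNf-index (nf-lift R)         zero    = VarLift _ ◅ ε
shiftNf-index (nf-lift {s = s} R) (suc i) = ShiftLift _ s ◅ closL* shift (shiftNf-index R i)

shiftNf-readback : ∀ {n s ρ m} → ShiftNf n s ρ m →
                   ∀ t → clos (readback m t) s ⟶* readback n (ren ρ t)
shiftNf-readback R (con x) = shiftNf-const R (var x)
shiftNf-readback R (ix i)  = shiftNf-index R i
shiftNf-readback {s = s} R (t · u) =
  App _ _ s ◅ app* (shiftNf-readback R t) (shiftNf-readback R u)
shiftNf-readback {s = s} R (ƛ t) =
  Lambda _ s ◅ lam* (shiftNf-readback (nf-lift R) t)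

shift-readback : ∀ n t → clos (readback n t) shift ⟶* readback (suc n) (ren suc t)
shift-readback n = shiftNf-readback (nf-shift n)

-- SubstNf n s σ m: s is a substitution from level m to level n, free of
-- closures except for shifts, which denotes σ.
data SubstNf : ℕ → Subst → Sub → ℕ → Set where
  nf-slash : ∀ n u → SubstNf n (slash (readback n u)) (u • ix) (suc n)
  nf-shift : ∀ n → SubstNf (suc n) shift (ix ∘ suc) n
  nf-id    : ∀ n → SubstNf (suc n) ids ix (suc n)
  nf-lift  : ∀ {n s σ m} → SubstNf n s σ m → SubstNf (suc n) (lift s) (exts σ) (suc m)

substNf-const : ∀ {n s σ m} → SubstNf n s σ m → ∀ a → clos (shifts m a) s ⟶* shifts n a
substNf-const (nf-slash n u)      a = Shift _ _ ◅ ε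
substNf-const (nf-shift n)        a = ε
substNf-const (nf-id n)           a = ShiftId _ ◅ ε
substNf-const (nf-lift {s = s} N) a = ShiftLift _ s ◅ closL* shift (substNf-const N a)

substNf-index : ∀ {n s σ m} → SubstNf n s σ m → ∀ i → clos (shifts i one) s ⟶* readback n (σ i)
substNf-index (nf-slash n u) zero    = Var _ ◅ ε
substNf-index (nf-slash n u) (suc i) = Shift _ _ ◅ ε
substNf-index (nf-shift n)   i       = ε
substNf-index (nf-id n)      zero    = VarId ◅ ε
substNf-index (nf-id n)      (suc i) = ShiftId _ ◅ ε
substNf-index (nf-lift N)    zero    = VarLift _ ◅ ε
substNf-index (nf-lift {n} {s} {σ} N) (suc i) =
  ShiftLift _ s ◅ closL* shift (substNf-index N i) ◅◅ shift-readback n (σ i)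

substNf-readback : ∀ {n s σ m} → SubstNf n s σ m →
                   ∀ t → clos (readback m t) s ⟶* readback n (sub σ t)
substNf-readback N (con x) = substNf-const N (var x)
substNf-readback N (ix i)  = substNf-index N i
substNf-readback {s = s} N (t · u) =
  App _ _ s ◅ app* (substNf-readback N t) (substNf-readback N u)
substNf-readback {s = s} N (ƛ t) =
  Lambda _ s ◅ lam* (substNf-readback (nf-lift N) t)

mutual
  normalise : ∀ {n a} → n ⊢ a → a ⟶* readback n ⟦ a ⟧
  normalise (wf-var x)   = ε
  normalise (wf-one n)   = ε
  normalise (wf-app A B) = app* (normalise A) (normalise B)
  normalise (wf-lam A)   = lam* (normalise A)
  normalise (wf-clos {m = m} {a} {s} S A) with normaliseₛ S
  ... | s' , s⟶*s' , N =
    closL* s (normalise A) ◅◅ closR* (readback m ⟦ a ⟧) s⟶*s' ◅◅ substNf-readback N ⟦ a ⟧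

  normaliseₛ : ∀ {n s m} → n ⊢ s ▷ m → Σ Subst (λ s' → (s ⟶ₛ* s') × SubstNf n s' ⟦ s ⟧ₛ m)
  normaliseₛ (wf-slash {n} {b} B) =
    slash (readback n ⟦ b ⟧) , gmap slash slashC (normalise B) , nf-slash n ⟦ b ⟧
  normaliseₛ (wf-shift n) = shift , ε , nf-shift n
  normaliseₛ (wf-id n)    = ids , ε , nf-id n
  normaliseₛ (wf-lift S) with normaliseₛ S
  ... | s' , s⟶*s' , N = lift s' , gmap lift liftC s⟶*s' , nf-lift N

-- Parallel β-steps are realised by λυ'-reductions of readbacks: a β-redex
-- is contracted by Beta and the resulting closure is pushed inside.
readback-⇛ : ∀ n {t t'} → t ⇛ t' → readback n t ⟶* readback n t'
readback-⇛ n (⇛con x)   = ε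
readback-⇛ n (⇛ix i)    = ε
readback-⇛ n (⇛app p q) = app* (readback-⇛ n p) (readback-⇛ n q)
readback-⇛ n (⇛lam p)   = lam* (readback-⇛ (suc n) p)
readback-⇛ n (⇛β {t' = t'} {u' = u'} p q) =
  app* (lam* (readback-⇛ (suc n) p)) (readback-⇛ n q)
  ◅◅ Beta _ _ ◅ substNf-readback (nf-slash n u') t'

readback-⇛* : ∀ n {t t'} → Star _⇛_ t t' → readback n t ⟶* readback n t'
readback-⇛* n ε        = ε
readback-⇛* n (p ◅ ps) = readback-⇛ n p ◅◅ readback-⇛* n ps

↠⇒⟶* : ∀ {a b} → a ↠ b → a ⟶* b
↠⇒⟶* refl↠          = ε
↠⇒⟶* (step↠ p a↠b) = p ◅ ↠⇒⟶* a↠b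

⟶*⇒↠ : ∀ {a b} → a ⟶* b → a ↠ b
⟶*⇒↠ ε          = refl↠
⟶*⇒↠ (p ◅ a⟶*b) = step↠ p (⟶*⇒↠ a⟶*b)

reduct-to-readback : ∀ {n a b t} → n ⊢ a → a ⟶* b → Star _⇛_ ⟦ b ⟧ t → b ⟶* readback n t
reduct-to-readback A a⟶*b ⟦b⟧⇛*t =
  normalise (subject-reduction* A a⟶*b) ◅◅ readback-⇛* _ ⟦b⟧⇛*t

mainTheorem16 : ∀ {a b c} → WellFormed a → a ↠ b → a ↠ c →
    Σ Term (λ d → (b ↠ d) × (c ↠ d))
mainTheorem16 (n , A) a↠b a↠c
  with ⇛-confluent (simulate* (↠⇒⟶* a↠b)) (simulate* (↠⇒⟶* a↠c))
... | t , ⟦b⟧⇛*t , ⟦c⟧⇛*t =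
  readback n t ,
  ⟶*⇒↠ (reduct-to-readback A (↠⇒⟶* a↠b) ⟦b⟧⇛*t) ,
  ⟶*⇒↠ (reduct-to-readback A (↠⇒⟶* a↠c) ⟦c⟧⇛*t)
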